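{- The Koszul dual $\mathbf{SP}^!=\mathbf{Free}_{G^\vee}/(R^\perp)$ of $\mathbf{SP}=\mathbf{Free}_G/(R)$ is isomorphic to the operad $\mathbf{Free}_{G^\vee}/(R')$, where $R'$ is the subspecies of $\mathbf{Free}_{G^\vee}$ generated by $r'_1=s^\vee_{a\ast}\circ_\ast s^\vee_{bc}$, $r'_2=p^\vee_{a\ast}\circ_\ast s^\vee_{bc}+s^\vee_{c\ast}\circ_\ast p^\vee_{ab}+s^\vee_{b\ast}\circ_\ast p^\vee_{ac}$, $r'_3=p^\vee_{a\ast}\circ_\ast p^\vee_{bc}+p^\vee_{c\ast}\circ_\ast p^\vee_{ab}+p^\vee_{b\ast}\circ_\ast p^\vee_{ca}$ (compositions in $\mathbf{Free}_{G^\vee}$, i.e. grafting).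
   Context: Field $\mathbb{K}$ of characteristic zero; operads in the species formalism. The graph insertion operad $\mathbb{K}\mathbf{G}$ has basis the simple graphs on $V$ and composition $g_1\circ_\ast g_2=\sum_{f:N_\ast\to V_2}\big((g_1\setminus\{\ast\})\cup g_2\cup\bigcup_{v\in N_\ast}\{\{v,f(v)\}\}\big)$ ($N_\ast$ the neighbours of $\ast$). For distinct $x,y$, $p_{xy}$ is the edgeless graph on $\{x,y\}$ and $s_{xy}$ the graph on $\{x,y\}$ with edge $\{x,y\}$. $\mathbf{SP}$ is the suboperad of $\mathbb{K}\mathbf{G}$ generated by $p_{ab},s_{ab}$; it is presented as $\mathbf{Free}_G/(R)$, where $G[V]$ is spanned by $p_V,s_V$ if $|V|=2$ and is $0$ otherwise, and $R$ is the subspecies of $\mathbf{Free}_G$ generated by $p_{c\ast}\circ_\ast p_{ab}-p_{a\ast}\circ_\ast p_{bc}$ and $s_{a\ast}\circ_\ast p_{bc}-p_{c\ast}\circ_\ast s_{ab}-p_{b\ast}\circ_\ast s_{ac}$. Here $\mathbf{Free}_H$ is the free operad on a species $H$ (trees with leaves labelled by $V$, internal nodes decorated by elements of $H$, composition by grafting), and $(R)$ is the ideal generated by $R$. For a species $S$, $S^\vee[V]=S[V]^*$ with $S^\vee[\sigma](x)=\mathrm{sign}(\sigma)\,x\circ S[\sigma^{ -1}]$. $p^\vee_{xy},s^\vee_{xy}\in G^\vee[\{x,y\}]$ denote the basis dual to $p_{xy},s_{xy}$. Koszul duality: define the bilinear pairing between the arity-$\{a,b,c\}$ parts of $\mathbf{Free}_{G^\vee}$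 and $\mathbf{Free}_G$ spanned by two-node trees by $\langle f_1\circ_\ast f_2,\,x_1\circ_\ast x_2\rangle=f_1(x_1)f_2(x_2)$ for $f_1,x_1$ in arity $\{u,\ast\}$ and $f_2,x_2$ in arity $\{v,w\}$ (and $0$ when the underlying labelled tree shapes differ); $R^\perp$ is the orthogonal of $R$ for this pairing, and the Koszul dual of $\mathbf{Free}_G/(R)$ is $\mathbf{Free}_{G^\vee}/(R^\perp)$. -}

module Defs where

open import Level using (Level; _⊔_)
open import Algebra.Bundles using (CommutativeRing)
open import Data.Nat using (ℕ; zero) renaming (suc to sucℕ)
open import Data.Fin using (Fin; zero; suc)
open import Data.Fin.Permutation using (Permutation′; _⟨$⟩ʳ_)
open import Data.Product using (Σ; _×_; _,_; ∃-syntax)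
open import Data.Sum using (_⊎_)
open import Relation.Nullary using (¬_)
open import Relation.Binary.PropositionalEquality using (_≡_)
open import Relation.Nullary.Decidable using (⌊_⌋)
open import Data.Fin using (_≟_)
open import Data.Bool using (Bool; true; false; _∧_; if_then_else_)

record Field (c ℓ : Level) : Set (Level.suc (c ⊔ ℓ)) where
  field
    commutativeRing : CommutativeRing c ℓ
  open CommutativeRing commutativeRing public
  field
    1≉0     : ¬ (1# ≈ 0#)
    inverse : ∀ x → ¬ (x ≈ 0#) → Σ Carrier λ y → (x * y) ≈ 1#

module _ {k ℓ} (K : Field k ℓ) where
  open Field K

  embedℕ : ℕ → Carrier
  embedℕ zero     = 0#
  embedℕ (sucℕ n) = 1# + embedℕ n

  CharZero : Set ℓ
  CharZero = ∀ n → embedℕ n ≈ 0# → n ≡ 0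

-- Generators: G[V] for |V| = 2 has basis p_V , s_V ; G^∨[V] has the dual
-- basis p^∨_V , s^∨_V .

data Gen : Set where
  p s : Gen

_==ᴳ_ : Gen → Gen → Bool
p ==ᴳ p = true
s ==ᴳ s = true
_ ==ᴳ _ = false

Label : Set
Label = Fin 3

a b c : Label
a = zero
b = suc zero
c = suc (suc zero)

-- A two-node tree with leaves {a,b,c}: the root node has leaves {u,∗}
-- (u = the leaf attached at the root), the child node (grafted at ∗) has
-- the two remaining leaves {v,w}.  A basis element of the arity-{a,b,c}
-- weight-2 part of Free_G (resp. Free_{G^∨}) is such a tree together with a
-- decoration of the root node and of the child node by basis elements of
-- G (resp. G^∨).
record Tree : Set where
  constructor tree
  field
    rootLeaf : Label
    rootDec  : Gen
    childDec : Gen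

module Spaces {k ℓ} (K : Field k ℓ) where
  open Field K

  -- Elements of the arity-{a,b,c} two-node-tree part of Free_G and of
  -- Free_{G^∨}: coordinates w.r.t. the tree basis.
  Vect : Set k
  Vect = Tree → Carrier

  FreeG₃ : Set k
  FreeG₃ = Vect

  FreeG∨₃ : Set k
  FreeG∨₃ = Vect

  _≈ᵥ_ : Vect → Vect → Set ℓ
  x ≈ᵥ y = ∀ t → x t ≈ y t

  0ᵥ : Vect
  0ᵥ _ = 0#

  _+ᵥ_ : Vect → Vect → Vect
  (x +ᵥ y) t = x t + y t

  _-ᵥ_ : Vect → Vect → Vect
  (x -ᵥ y) t = x t - y t

  _·ᵥ_ : Carrier → Vect → Vect
  (k ·ᵥ x) t = k * x t

  infixl 6 _+ᵥ_ _-ᵥ_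
  infixl 7 _·ᵥ_

  -- Two-node tree  g₁_{u∗} ∘_∗ g₂_{vw}  (grafting), where {u,v,w} = {a,b,c};
  -- as a basis element it only depends on u, g₁, g₂ (the child carries the
  -- complement {v,w} of u, and p_{vw} = p_{wv}, s_{vw} = s_{wv}, so the
  -- dual basis elements p^∨_{vw}, s^∨_{vw} do not depend on the order).
  -- The arguments v w are kept to mirror the paper's notation.
  graft : Gen → Label → Gen → Label → Label → Vect
  graft g₁ u g₂ v w (tree u′ g₁′ g₂′) =
    if ⌊ u′ ≟ u ⌋ ∧ (g₁′ ==ᴳ g₁) ∧ (g₂′ ==ᴳ g₂) then 1# else 0#

  -- The pairing of Free_{G^∨} with Free_G on two-node trees:
  -- ⟨f₁ ∘_∗ f₂ , x₁ ∘_∗ x₂⟩ = f₁(x₁) f₂(x₂), and 0 for different shapes;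
  -- on the (dual) tree bases this is the sum of coordinate products.
  sumGen : (Gen → Carrier) → Carrier
  sumGen h = h p + h s

  sumLabel : (Label → Carrier) → Carrier
  sumLabel h = h a + h b + h c

  ⟪_,_⟫ : FreeG∨₃ → FreeG₃ → Carrier
  ⟪ f , x ⟫ = sumLabel λ u → sumGen λ g₁ → sumGen λ g₂ →
                f (tree u g₁ g₂) * x (tree u g₁ g₂)

  data Span (P : Vect → Set k) : Vect → Set (k ⊔ ℓ) where
    sp-gen   : ∀ {x} → P x → Span P x
    sp-zero  : Span P 0ᵥ
    sp-add   : ∀ {x y} → Span P x → Span P y → Span P (x +ᵥ y)
    sp-scale : ∀ k {x} → Span P x → Span P (k ·ᵥ x)
    sp-resp  : ∀ {x y} → x ≈ᵥ y → Span P x → Span P y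

  -- The subspecies generated by a family of relations, in arity {a,b,c}:
  -- the span of all relabellings of the relations by bijections
  -- σ : {a,b,c} → {a,b,c}.
  GeneratedBy : {I : Set} → (I → Permutation′ 3 → Vect) → Vect → Set (k ⊔ ℓ)
  GeneratedBy {I} r = Span (λ x → Σ (I × Permutation′ 3) λ { (i , σ) → x ≡ r i σ })

  rel : Fin 2 → Permutation′ 3 → FreeG₃
  rel zero σ =
    graft p (σ ⟨$⟩ʳ c) p (σ ⟨$⟩ʳ a) (σ ⟨$⟩ʳ b) -ᵥ graft p (σ ⟨$⟩ʳ a) p (σ ⟨$⟩ʳ b) (σ ⟨$⟩ʳ c)
  rel (suc _) σ =
    graft s (σ ⟨$⟩ʳ a) p (σ ⟨$⟩ʳ b) (σ ⟨$⟩ʳ c)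
      -ᵥ graft p (σ ⟨$⟩ʳ c) s (σ ⟨$⟩ʳ a) (σ ⟨$⟩ʳ b)
      -ᵥ graft p (σ ⟨$⟩ʳ b) s (σ ⟨$⟩ʳ a) (σ ⟨$⟩ʳ c)

  R : FreeG₃ → Set (k ⊔ ℓ)
  R = GeneratedBy rel

  R⊥ : FreeG∨₃ → Set (k ⊔ ℓ)
  R⊥ f = ∀ x → R x → ⟪ f , x ⟫ ≈ 0#

  -- Relations R′ (in Free_{G^∨}), relabelled by σ (the global sign(σ)
  -- factor of the G^∨-action is omitted: it does not change spans).
  rel′ : Fin 3 → Permutation′ 3 → FreeG∨₃
  rel′ zero σ = graft s (σ ⟨$⟩ʳ a) s (σ ⟨$⟩ʳ b) (σ ⟨$⟩ʳ c)
  rel′ (suc zero) σ =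
    graft p (σ ⟨$⟩ʳ a) s (σ ⟨$⟩ʳ b) (σ ⟨$⟩ʳ c)
      +ᵥ graft s (σ ⟨$⟩ʳ c) p (σ ⟨$⟩ʳ a) (σ ⟨$⟩ʳ b)
      +ᵥ graft s (σ ⟨$⟩ʳ b) p (σ ⟨$⟩ʳ a) (σ ⟨$⟩ʳ c)
  rel′ (suc (suc _)) σ =
    graft p (σ ⟨$⟩ʳ a) p (σ ⟨$⟩ʳ b) (σ ⟨$⟩ʳ c)
      +ᵥ graft p (σ ⟨$⟩ʳ c) p (σ ⟨$⟩ʳ a) (σ ⟨$⟩ʳ b)
      +ᵥ graft p (σ ⟨$⟩ʳ b) p (σ ⟨$⟩ʳ c) (σ ⟨$⟩ʳ a)

  R′ : FreeG∨₃ → Set (k ⊔ ℓ)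
  R′ = GeneratedBy rel′

-- Pairing with a tree basis vector reads off a coordinate, so R^⊥ is cut out by the
-- equations "f(u,p,p) does not depend on u" and "f(u,s,p) = f(v,p,s) + f(w,p,s)"
-- for {u,v,w} = {a,b,c}.  Every relabelled r′ᵢ satisfies them; for r′₂ and r′₃ this
-- is because a bijection of {a,b,c} hits each label exactly once.  Hence R′ ⊆ R^⊥.
-- Conversely these equations leave free only the coordinates at (u,s,s), (a,p,p) and
-- (u,p,s), and suitable relabellings of r′₁, r′₃, r′₂ form the dual basis to them: if
-- f ∈ R^⊥, then f minus the corresponding combination of generators lies in R^⊥ and
-- vanishes at the free coordinates, hence is zero.

module Submission where

open import Defs
open import Level using (Level)
open import Data.Product using (_×_; _,_)
open import Data.Bool using (Bool; true; false; _∧_; if_then_else_)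
open import Data.Bool.Properties using (∧-assoc; ∧-identityʳ; ∧-zeroʳ)
open import Data.Empty using (⊥-elim)
open import Data.Fin using (Fin; zero; suc; _≟_)
open import Data.Fin.Permutation using (Permutation′; _⟨$⟩ʳ_; _⟨$⟩ˡ_; inverseʳ; transpose; id)
open import Function.Bundles using (Injection)
open import Function.Properties.Inverse using (↔⇒↣)
open import Relation.Nullary using (yes; no)
open import Relation.Nullary.Decidable using (⌊_⌋)
import Relation.Binary.PropositionalEquality as ≡
open ≡ using (_≡_; refl)

module KoszulDual {k ℓ} (K : Field k ℓ) where
  open Field K hiding (zero; refl)
  open Spaces K
  open import Relation.Binary.Reasoning.Setoid setoid
  open import Algebra.Properties.Ring ring using (-1*x≈-x)
  open import Algebra.Properties.Group +-group using (∙-cancelˡ; x∙y⁻¹≈ε⇒x≈y; x≈y⇒x∙y⁻¹≈ε)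
  open import Algebra.Properties.AbelianGroup +-abelianGroup using (⁻¹-∙-comm)
  open import Algebra.Properties.CommutativeSemigroup +-commutativeSemigroup
    using (interchange; xy∙z≈xz∙y)
  open import Algebra.Properties.CommutativeSemigroup *-commutativeSemigroup
    using () renaming (x∙yz≈y∙xz to x*yz≈y*xz)

  ind : Bool → Carrier
  ind β = if β then 1# else 0#

  [_≐_] : Label → Label → Carrier
  [ x ≐ y ] = ind ⌊ x ≟ y ⌋

  ind-∧-true : ∀ {β} → ind (β ∧ true) ≈ ind β
  ind-∧-true {β} = reflexive (≡.cong ind (∧-identityʳ β))

  ind-∧-false : ∀ {β} → ind (β ∧ false) ≈ 0#
  ind-∧-false {β} = reflexive (≡.cong ind (∧-zeroʳ β))

  ≐-sym : ∀ x y → [ x ≐ y ] ≡ [ y ≐ x ]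
  ≐-sym x y with x ≟ y | y ≟ x
  ... | yes _   | yes _   = refl
  ... | no _    | no _    = refl
  ... | yes x≡y | no y≢x  = ⊥-elim (y≢x (≡.sym x≡y))
  ... | no x≢y  | yes y≡x = ⊥-elim (x≢y (≡.sym y≡x))

  ≐-perm : ∀ (σ : Permutation′ 3) x y → [ σ ⟨$⟩ʳ x ≐ σ ⟨$⟩ʳ y ] ≡ [ x ≐ y ]
  ≐-perm σ x y with x ≟ y | σ ⟨$⟩ʳ x ≟ σ ⟨$⟩ʳ y
  ... | yes _   | yes _     = refl
  ... | no _    | no _      = refl
  ... | yes x≡y | no σx≢σy  = ⊥-elim (σx≢σy (≡.cong (σ ⟨$⟩ʳ_) x≡y))
  ... | no x≢y  | yes σx≡σy = ⊥-elim (x≢y (Injection.injective (↔⇒↣ σ) σx≡σy))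

  -- ⟪ f , x ⟫ unfolds to sumTree (λ t → f t * x t).
  sumTree : (Tree → Carrier) → Carrier
  sumTree h = sumLabel λ u → sumGen λ g₁ → sumGen λ g₂ → h (tree u g₁ g₂)

  sumGen-cong : ∀ {h h′} → (∀ g → h g ≈ h′ g) → sumGen h ≈ sumGen h′
  sumGen-cong h≈h′ = +-cong (h≈h′ p) (h≈h′ s)

  sumLabel-cong : ∀ {h h′} → (∀ u → h u ≈ h′ u) → sumLabel h ≈ sumLabel h′
  sumLabel-cong h≈h′ = +-cong (+-cong (h≈h′ a) (h≈h′ b)) (h≈h′ c)

  sumTree-cong : ∀ {h h′} → (∀ t → h t ≈ h′ t) → sumTree h ≈ sumTree h′
  sumTree-cong h≈h′ =
    sumLabel-cong λ u → sumGen-cong λ g₁ → sumGen-cong λ g₂ → h≈h′ (tree u g₁ g₂)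

  sumGen-+ : ∀ h h′ → sumGen (λ g → h g + h′ g) ≈ sumGen h + sumGen h′
  sumGen-+ h h′ = interchange (h p) (h′ p) (h s) (h′ s)

  sumLabel-+ : ∀ h h′ → sumLabel (λ u → h u + h′ u) ≈ sumLabel h + sumLabel h′
  sumLabel-+ h h′ = trans (+-congʳ (interchange _ _ _ _)) (interchange _ _ _ _)

  sumTree-+ : ∀ h h′ → sumTree (λ t → h t + h′ t) ≈ sumTree h + sumTree h′
  sumTree-+ h h′ = trans
    (sumLabel-cong λ u → trans
      (sumGen-cong λ g₁ → sumGen-+ (λ g₂ → h (tree u g₁ g₂)) (λ g₂ → h′ (tree u g₁ g₂)))
      (sumGen-+ (λ g₁ → sumGen λ g₂ → h (tree u g₁ g₂)) (λ g₁ → sumGen λ g₂ → h′ (tree u g₁ g₂))))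
    (sumLabel-+ (λ u → sumGen λ g₁ → sumGen λ g₂ → h (tree u g₁ g₂))
                (λ u → sumGen λ g₁ → sumGen λ g₂ → h′ (tree u g₁ g₂)))

  sumGen-* : ∀ x h → sumGen (λ g → x * h g) ≈ x * sumGen h
  sumGen-* x h = sym (distribˡ x (h p) (h s))

  sumLabel-* : ∀ x h → sumLabel (λ u → x * h u) ≈ x * sumLabel h
  sumLabel-* x h = sym (trans (distribˡ x _ _) (+-congʳ (distribˡ x _ _)))

  sumTree-* : ∀ x h → sumTree (λ t → x * h t) ≈ x * sumTree h
  sumTree-* x h = trans
    (sumLabel-cong λ u → trans
      (sumGen-cong λ g₁ → sumGen-* x (λ g₂ → h (tree u g₁ g₂)))
      (sumGen-* x (λ g₁ → sumGen λ g₂ → h (tree u g₁ g₂))))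
    (sumLabel-* x (λ u → sumGen λ g₁ → sumGen λ g₂ → h (tree u g₁ g₂)))

  zero₃ : 0# + 0# + 0# ≈ 0#
  zero₃ = trans (+-identityʳ _) (+-identityʳ 0#)

  sumLabel-zeroʳ : ∀ (h : Label → Carrier) → sumLabel (λ u → h u * 0#) ≈ 0#
  sumLabel-zeroʳ h = trans (sumLabel-cong λ u → zeroʳ (h u)) zero₃

  pair-cong : ∀ f {x y} → x ≈ᵥ y → ⟪ f , x ⟫ ≈ ⟪ f , y ⟫
  pair-cong f {x} {y} x≈y =
    sumTree-cong {λ t → f t * x t} {λ t → f t * y t} λ t → *-congˡ (x≈y t)

  pair-comm : ∀ f x → ⟪ f , x ⟫ ≈ ⟪ x , f ⟫
  pair-comm f x = sumTree-cong {λ t → f t * x t} {λ t → x t * f t} λ t → *-comm (f t) (x t)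

  pair-+ : ∀ f x y → ⟪ f , x +ᵥ y ⟫ ≈ ⟪ f , x ⟫ + ⟪ f , y ⟫
  pair-+ f x y = trans (sumTree-cong {λ t → f t * (x t + y t)} λ t → distribˡ (f t) (x t) (y t))
                       (sumTree-+ (λ t → f t * x t) (λ t → f t * y t))

  pair-· : ∀ f κ x → ⟪ f , κ ·ᵥ x ⟫ ≈ κ * ⟪ f , x ⟫
  pair-· f κ x = trans (sumTree-cong {λ t → f t * (κ * x t)} λ t → x*yz≈y*xz (f t) κ (x t))
                       (sumTree-* κ (λ t → f t * x t))

  pair-0 : ∀ f → ⟪ f , 0ᵥ ⟫ ≈ 0#
  pair-0 f = begin
    ⟪ f , 0ᵥ ⟫        ≈⟨ pair-cong f {0ᵥ} (λ _ → sym (zeroˡ 0#)) ⟩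
    ⟪ f , 0# ·ᵥ 0ᵥ ⟫  ≈⟨ pair-· f 0# 0ᵥ ⟩
    0# * ⟪ f , 0ᵥ ⟫   ≈⟨ zeroˡ _ ⟩
    0#                ∎

  pair-- : ∀ f x y → ⟪ f , x -ᵥ y ⟫ ≈ ⟪ f , x ⟫ - ⟪ f , y ⟫
  pair-- f x y = begin
    ⟪ f , x -ᵥ y ⟫                   ≈⟨ pair-cong f {x -ᵥ y} (λ t → +-congˡ (sym (-1*x≈-x (y t)))) ⟩
    ⟪ f , x +ᵥ - 1# ·ᵥ y ⟫           ≈⟨ pair-+ f x (- 1# ·ᵥ y) ⟩
    ⟪ f , x ⟫ + ⟪ f , - 1# ·ᵥ y ⟫    ≈⟨ +-congˡ (trans (pair-· f (- 1#) y) (-1*x≈-x _)) ⟩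
    ⟪ f , x ⟫ - ⟪ f , y ⟫            ∎

  ⊥-Span : ∀ {P} f → (∀ {x} → P x → ⟪ f , x ⟫ ≈ 0#) → ∀ {x} → Span P x → ⟪ f , x ⟫ ≈ 0#
  ⊥-Span f f⊥P (sp-gen x∈P) = f⊥P x∈P
  ⊥-Span f f⊥P sp-zero = pair-0 f
  ⊥-Span f f⊥P (sp-add {x} {y} x∈S y∈S) = begin
    ⟪ f , x +ᵥ y ⟫         ≈⟨ pair-+ f x y ⟩
    ⟪ f , x ⟫ + ⟪ f , y ⟫  ≈⟨ +-cong (⊥-Span f f⊥P x∈S) (⊥-Span f f⊥P y∈S) ⟩
    0# + 0#                ≈⟨ +-identityʳ 0# ⟩
    0#                     ∎
  ⊥-Span f f⊥P (sp-scale κ {x} x∈S) =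
    trans (pair-· f κ x) (trans (*-congˡ (⊥-Span f f⊥P x∈S)) (zeroʳ κ))
  ⊥-Span f f⊥P (sp-resp x≈y x∈S) = trans (sym (pair-cong f x≈y)) (⊥-Span f f⊥P x∈S)

  sumGen-δ : ∀ β g₀ (h : Gen → Carrier) →
             sumGen (λ g → h g * ind (β ∧ (g ==ᴳ g₀))) ≈ h g₀ * ind β
  sumGen-δ β p h rewrite ∧-identityʳ β | ∧-zeroʳ β = trans (+-congˡ (zeroʳ (h s))) (+-identityʳ _)
  sumGen-δ β s h rewrite ∧-identityʳ β | ∧-zeroʳ β = trans (+-congʳ (zeroʳ (h p))) (+-identityˡ _)

  sumLabel-δ : ∀ u₀ (h : Label → Carrier) → sumLabel (λ u → h u * [ u ≐ u₀ ]) ≈ h u₀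
  sumLabel-δ zero h = trans (+-cong (+-cong (*-identityʳ _) (zeroʳ _)) (zeroʳ _))
                            (trans (+-identityʳ _) (+-identityʳ _))
  sumLabel-δ (suc zero) h = trans (+-cong (+-cong (zeroʳ _) (*-identityʳ _)) (zeroʳ _))
                                  (trans (+-identityʳ _) (+-identityˡ _))
  sumLabel-δ (suc (suc zero)) h = trans (+-cong (+-cong (zeroʳ _) (zeroʳ _)) (*-identityʳ _))
                                        (trans (+-congʳ (+-identityʳ 0#)) (+-identityˡ _))

  sumLabel-δ′ : ∀ u₀ (h : Label → Carrier) → sumLabel (λ u → h u * [ u₀ ≐ u ]) ≈ h u₀
  sumLabel-δ′ u₀ h =
    trans (sumLabel-cong λ u → reflexive (≡.cong (h u *_) (≐-sym u₀ u))) (sumLabel-δ u₀ h)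

  pair-graft : ∀ f {g₁ u g₂ v w} → ⟪ f , graft g₁ u g₂ v w ⟫ ≈ f (tree u g₁ g₂)
  pair-graft f {g₁} {u} {g₂} {v} {w} = begin
    sumTree (λ t → f t * graft g₁ u g₂ v w t)
      ≈⟨ sumTree-cong (λ { (tree u′ g₁′ g₂′) →
           *-congˡ {f (tree u′ g₁′ g₂′)}
             (reflexive (≡.cong ind (≡.sym (∧-assoc ⌊ u′ ≟ u ⌋ (g₁′ ==ᴳ g₁) (g₂′ ==ᴳ g₂))))) }) ⟩
    sumLabel (λ u′ → sumGen λ g₁′ → sumGen λ g₂′ →
      f (tree u′ g₁′ g₂′) * ind ((⌊ u′ ≟ u ⌋ ∧ (g₁′ ==ᴳ g₁)) ∧ (g₂′ ==ᴳ g₂)))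
      ≈⟨ sumLabel-cong (λ u′ → sumGen-cong λ g₁′ →
           sumGen-δ (⌊ u′ ≟ u ⌋ ∧ (g₁′ ==ᴳ g₁)) g₂ (λ g₂′ → f (tree u′ g₁′ g₂′))) ⟩
    sumLabel (λ u′ → sumGen λ g₁′ → f (tree u′ g₁′ g₂) * ind (⌊ u′ ≟ u ⌋ ∧ (g₁′ ==ᴳ g₁)))
      ≈⟨ sumLabel-cong (λ u′ → sumGen-δ ⌊ u′ ≟ u ⌋ g₁ (λ g₁′ → f (tree u′ g₁′ g₂))) ⟩
    sumLabel (λ u′ → f (tree u′ g₁ g₂) * [ u′ ≐ u ])
      ≈⟨ sumLabel-δ u (λ u′ → f (tree u′ g₁ g₂)) ⟩
    f (tree u g₁ g₂) ∎

  preimage-count : ∀ (σ : Permutation′ 3) u → sumLabel (λ x → [ u ≐ σ ⟨$⟩ʳ x ]) ≈ 1#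
  preimage-count σ u = begin
    sumLabel (λ x → [ u ≐ σ ⟨$⟩ʳ x ])
      ≡⟨ ≡.cong (λ v → sumLabel (λ x → [ v ≐ σ ⟨$⟩ʳ x ])) (≡.sym (inverseʳ σ)) ⟩
    sumLabel (λ x → [ σ ⟨$⟩ʳ z ≐ σ ⟨$⟩ʳ x ])
      ≈⟨ sumLabel-cong (λ x → trans (reflexive (≐-perm σ z x)) (sym (*-identityˡ _))) ⟩
    sumLabel (λ x → 1# * [ z ≐ x ])
      ≈⟨ sumLabel-δ′ z (λ _ → 1#) ⟩
    1# ∎
    where
    z = σ ⟨$⟩ˡ u

  absent₃ : ∀ {β γ δ} → ind (β ∧ false) + ind (γ ∧ false) + ind (δ ∧ false) ≈ 0#
  absent₃ = trans (+-cong (+-cong ind-∧-false ind-∧-false) ind-∧-false) zero₃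

  coeff′ : Fin 3 → Permutation′ 3 → Label → Gen → Gen → Carrier
  coeff′ zero          τ u s s = [ u ≐ τ ⟨$⟩ʳ a ]
  coeff′ (suc zero)    τ u p s = [ u ≐ τ ⟨$⟩ʳ a ]
  coeff′ (suc zero)    τ u s p = [ u ≐ τ ⟨$⟩ʳ c ] + [ u ≐ τ ⟨$⟩ʳ b ]
  coeff′ (suc (suc _)) τ u p p = 1#
  coeff′ _             _ _ _ _ = 0#

  rel′≈coeff′ : ∀ j τ u g₁ g₂ → rel′ j τ (tree u g₁ g₂) ≈ coeff′ j τ u g₁ g₂
  rel′≈coeff′ zero τ u p p = ind-∧-false
  rel′≈coeff′ zero τ u p s = ind-∧-false
  rel′≈coeff′ zero τ u s p = ind-∧-false
  rel′≈coeff′ zero τ u s s = ind-∧-true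
  rel′≈coeff′ (suc zero) τ u p p = absent₃
  rel′≈coeff′ (suc zero) τ u p s = trans (+-cong (+-cong ind-∧-true ind-∧-false) ind-∧-false)
                                         (trans (+-identityʳ _) (+-identityʳ _))
  rel′≈coeff′ (suc zero) τ u s p = trans (+-cong (+-cong ind-∧-false ind-∧-true) ind-∧-true)
                                         (+-congʳ (+-identityˡ _))
  rel′≈coeff′ (suc zero) τ u s s = absent₃
  rel′≈coeff′ (suc (suc _)) τ u p p =
    trans (+-cong (+-cong ind-∧-true ind-∧-true) ind-∧-true)
          (trans (xy∙z≈xz∙y _ _ _) (preimage-count τ u))
  rel′≈coeff′ (suc (suc _)) τ u p s = absent₃
  rel′≈coeff′ (suc (suc _)) τ u s p = absent₃
  rel′≈coeff′ (suc (suc _)) τ u s s = absent₃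

  FlatAt : Vect → Permutation′ 3 → Set ℓ
  FlatAt f σ = f (tree (σ ⟨$⟩ʳ c) p p) ≈ f (tree (σ ⟨$⟩ʳ a) p p)

  SplitAt : Vect → Permutation′ 3 → Set ℓ
  SplitAt f σ = f (tree (σ ⟨$⟩ʳ a) s p) ≈ f (tree (σ ⟨$⟩ʳ c) p s) + f (tree (σ ⟨$⟩ʳ b) p s)

  pair-rel₀ : ∀ f σ → ⟪ f , rel zero σ ⟫ ≈ f (tree (σ ⟨$⟩ʳ c) p p) - f (tree (σ ⟨$⟩ʳ a) p p)
  pair-rel₀ f σ = trans (pair-- f (graft p σc p σa σb) (graft p σa p σb σc))
                        (+-cong (pair-graft f {v = σa} {σb}) (-‿cong (pair-graft f {v = σb} {σc})))
    where
    σa = σ ⟨$⟩ʳ a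
    σb = σ ⟨$⟩ʳ b
    σc = σ ⟨$⟩ʳ c

  pair-rel₁ : ∀ f i σ → ⟪ f , rel (suc i) σ ⟫ ≈
    f (tree (σ ⟨$⟩ʳ a) s p) - f (tree (σ ⟨$⟩ʳ c) p s) - f (tree (σ ⟨$⟩ʳ b) p s)
  pair-rel₁ f i σ = trans (pair-- f (graft s σa p σb σc -ᵥ graft p σc s σa σb) (graft p σb s σa σc))
    (+-cong (trans (pair-- f (graft s σa p σb σc) (graft p σc s σa σb))
                   (+-cong (pair-graft f {v = σb} {σc}) (-‿cong (pair-graft f {v = σa} {σb}))))
            (-‿cong (pair-graft f {v = σa} {σc})))
    where
    σa = σ ⟨$⟩ʳ a
    σb = σ ⟨$⟩ʳ b
    σc = σ ⟨$⟩ʳ c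

  x-y-z≈x-[y+z] : ∀ x y z → x - y - z ≈ x - (y + z)
  x-y-z≈x-[y+z] x y z = trans (+-assoc x (- y) (- z)) (+-congˡ (⁻¹-∙-comm y z))

  FlatAt⇒⊥rel₀ : ∀ f σ → FlatAt f σ → ⟪ f , rel zero σ ⟫ ≈ 0#
  FlatAt⇒⊥rel₀ f σ flat = trans (pair-rel₀ f σ) (x≈y⇒x∙y⁻¹≈ε flat)

  ⊥rel₀⇒FlatAt : ∀ f σ → ⟪ f , rel zero σ ⟫ ≈ 0# → FlatAt f σ
  ⊥rel₀⇒FlatAt f σ ⊥ = x∙y⁻¹≈ε⇒x≈y _ _ (trans (sym (pair-rel₀ f σ)) ⊥)

  SplitAt⇒⊥rel₁ : ∀ f i σ → SplitAt f σ → ⟪ f , rel (suc i) σ ⟫ ≈ 0#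
  SplitAt⇒⊥rel₁ f i σ split =
    trans (pair-rel₁ f i σ) (trans (x-y-z≈x-[y+z] _ _ _) (x≈y⇒x∙y⁻¹≈ε split))

  ⊥rel₁⇒SplitAt : ∀ f i σ → ⟪ f , rel (suc i) σ ⟫ ≈ 0# → SplitAt f σ
  ⊥rel₁⇒SplitAt f i σ ⊥ =
    x∙y⁻¹≈ε⇒x≈y _ _ (trans (sym (x-y-z≈x-[y+z] _ _ _)) (trans (sym (pair-rel₁ f i σ)) ⊥))

  coeff′-pp : ∀ j {τ u v} → coeff′ j τ u p p ≡ coeff′ j τ v p p
  coeff′-pp zero          = refl
  coeff′-pp (suc zero)    = refl
  coeff′-pp (suc (suc _)) = refl

  rel′-flat : ∀ j τ σ → FlatAt (rel′ j τ) σ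
  rel′-flat j τ σ = begin
    rel′ j τ (tree (σ ⟨$⟩ʳ c) p p)  ≈⟨ rel′≈coeff′ j τ (σ ⟨$⟩ʳ c) p p ⟩
    coeff′ j τ (σ ⟨$⟩ʳ c) p p       ≡⟨ coeff′-pp j ⟩
    coeff′ j τ (σ ⟨$⟩ʳ a) p p       ≈⟨ sym (rel′≈coeff′ j τ (σ ⟨$⟩ʳ a) p p) ⟩
    rel′ j τ (tree (σ ⟨$⟩ʳ a) p p)  ∎

  SplitAt-unmixed : ∀ f → (∀ u → f (tree u s p) ≈ 0#) → (∀ u → f (tree u p s) ≈ 0#) →
                    ∀ σ → SplitAt f σ
  SplitAt-unmixed f sp≈0 ps≈0 σ =
    trans (sp≈0 _) (sym (trans (+-cong (ps≈0 _) (ps≈0 _)) (+-identityʳ 0#)))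

  rel′₁-split : ∀ τ σ → SplitAt (rel′ (suc zero) τ) σ
  rel′₁-split τ σ = begin
    rel′ (suc zero) τ (tree (σ ⟨$⟩ʳ a) s p)  ≈⟨ rel′≈coeff′ (suc zero) τ σa s p ⟩
    [ σa ≐ τc ] + [ σa ≐ τb ]                ≈⟨ +-comm _ _ ⟩
    [ σa ≐ τb ] + [ σa ≐ τc ]                ≈⟨ ∙-cancelˡ [ σa ≐ τa ] _ _ counted-twice ⟩
    [ σb ≐ τa ] + [ σc ≐ τa ]                ≈⟨ +-comm _ _ ⟩
    [ σc ≐ τa ] + [ σb ≐ τa ]                ≈⟨ sym (+-cong (rel′≈coeff′ (suc zero) τ σc p s)
                                                             (rel′≈coeff′ (suc zero) τ σb p s)) ⟩
    rel′ (suc zero) τ (tree σc p s) + rel′ (suc zero) τ (tree σb p s) ∎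
    where
    σa = σ ⟨$⟩ʳ a
    σb = σ ⟨$⟩ʳ b
    σc = σ ⟨$⟩ʳ c
    τa = τ ⟨$⟩ʳ a
    τb = τ ⟨$⟩ʳ b
    τc = τ ⟨$⟩ʳ c
    counted-twice : [ σa ≐ τa ] + ([ σa ≐ τb ] + [ σa ≐ τc ])
                  ≈ [ σa ≐ τa ] + ([ σb ≐ τa ] + [ σc ≐ τa ])
    counted-twice = begin
      [ σa ≐ τa ] + ([ σa ≐ τb ] + [ σa ≐ τc ])  ≈⟨ sym (+-assoc _ _ _) ⟩
      sumLabel (λ x → [ σa ≐ τ ⟨$⟩ʳ x ])         ≈⟨ preimage-count τ σa ⟩
      1#                                         ≈⟨ sym (preimage-count σ τa) ⟩
      sumLabel (λ x → [ τa ≐ σ ⟨$⟩ʳ x ])         ≈⟨ sumLabel-cong (λ x → reflexive (≐-sym τa (σ ⟨$⟩ʳ x))) ⟩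
      sumLabel (λ x → [ σ ⟨$⟩ʳ x ≐ τa ])         ≈⟨ +-assoc _ _ _ ⟩
      [ σa ≐ τa ] + ([ σb ≐ τa ] + [ σc ≐ τa ])  ∎

  rel′-split : ∀ j τ σ → SplitAt (rel′ j τ) σ
  rel′-split zero τ σ = SplitAt-unmixed (rel′ zero τ)
    (λ u → rel′≈coeff′ zero τ u s p) (λ u → rel′≈coeff′ zero τ u p s) σ
  rel′-split (suc zero) τ σ = rel′₁-split τ σ
  rel′-split (suc (suc i)) τ σ = SplitAt-unmixed (rel′ (suc (suc i)) τ)
    (λ u → rel′≈coeff′ (suc (suc i)) τ u s p) (λ u → rel′≈coeff′ (suc (suc i)) τ u p s) σ

  rel′⊥rel : ∀ j τ i σ → ⟪ rel′ j τ , rel i σ ⟫ ≈ 0#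
  rel′⊥rel j τ zero    σ = FlatAt⇒⊥rel₀ (rel′ j τ) σ (rel′-flat j τ σ)
  rel′⊥rel j τ (suc i) σ = SplitAt⇒⊥rel₁ (rel′ j τ) i σ (rel′-split j τ σ)

  R′⊆R⊥ : ∀ {f} → R′ f → R⊥ f
  R′⊆R⊥ {f} f∈R′ _ x∈R =
    ⊥-Span f (λ { ((i , σ) , refl) → trans (pair-comm f (rel i σ)) (rel⊥R′ i σ) }) x∈R
    where
    rel⊥R′ : ∀ i σ → ⟪ rel i σ , f ⟫ ≈ 0#
    rel⊥R′ i σ = ⊥-Span (rel i σ)
      (λ { ((j , τ) , refl) → trans (pair-comm (rel i σ) (rel′ j τ)) (rel′⊥rel j τ i σ) }) f∈R′

  R⊥-flat : ∀ {f} → R⊥ f → ∀ σ → FlatAt f σ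
  R⊥-flat {f} f⊥R σ = ⊥rel₀⇒FlatAt f σ (f⊥R (rel zero σ) (sp-gen ((zero , σ) , refl)))

  R⊥-split : ∀ {f} → R⊥ f → ∀ σ → SplitAt f σ
  R⊥-split {f} f⊥R σ =
    ⊥rel₁⇒SplitAt f zero σ (f⊥R (rel (suc zero) σ) (sp-gen ((suc zero , σ) , refl)))

  R⊥-−ᵥ : ∀ {f g} → R⊥ f → R⊥ g → R⊥ (f -ᵥ g)
  R⊥-−ᵥ {f} {g} f⊥R g⊥R x x∈R = begin
    ⟪ f -ᵥ g , x ⟫         ≈⟨ pair-comm (f -ᵥ g) x ⟩
    ⟪ x , f -ᵥ g ⟫         ≈⟨ pair-- x f g ⟩
    ⟪ x , f ⟫ - ⟪ x , g ⟫  ≈⟨ +-cong (trans (pair-comm x f) (f⊥R x x∈R))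
                                     (-‿cong (trans (pair-comm x g) (g⊥R x x∈R))) ⟩
    0# - 0#                ≈⟨ -‿inverseʳ 0# ⟩
    0#                     ∎

  R⊥-vanishing : ∀ {g} → R⊥ g →
    (∀ u → g (tree u s s) ≈ 0#) → g (tree a p p) ≈ 0# → (∀ u → g (tree u p s) ≈ 0#) →
    g ≈ᵥ 0ᵥ
  R⊥-vanishing     g⊥R ss≈0 pp≈0 ps≈0 (tree u s s) = ss≈0 u
  R⊥-vanishing     g⊥R ss≈0 pp≈0 ps≈0 (tree u p s) = ps≈0 u
  R⊥-vanishing {g} g⊥R ss≈0 pp≈0 ps≈0 (tree u s p) =
    trans (R⊥-split {g} g⊥R (transpose a u)) (trans (+-cong (ps≈0 _) (ps≈0 _)) (+-identityʳ 0#))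
  R⊥-vanishing     g⊥R ss≈0 pp≈0 ps≈0 (tree zero p p) = pp≈0
  R⊥-vanishing {g} g⊥R ss≈0 pp≈0 ps≈0 (tree (suc zero) p p) =
    trans (R⊥-flat {g} g⊥R (transpose b c)) pp≈0
  R⊥-vanishing {g} g⊥R ss≈0 pp≈0 ps≈0 (tree (suc (suc zero)) p p) =
    trans (R⊥-flat {g} g⊥R id) pp≈0

  Σᵥ : (Label → Vect) → Vect
  Σᵥ h t = sumLabel λ u → h u t

  Span-Σᵥ : ∀ {P h} → (∀ u → Span P (h u)) → Span P (Σᵥ h)
  Span-Σᵥ h∈S = sp-add (sp-add (h∈S a) (h∈S b)) (h∈S c)

  -- Since transpose a u sends a to u, the three families of generators below are dual to
  -- the coordinates at (u,s,s), (a,p,p) and (u,p,s).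
  expansion : Vect → Vect
  expansion f = Σᵥ (λ u → f (tree u s s) ·ᵥ rel′ zero (transpose a u))
             +ᵥ f (tree a p p) ·ᵥ rel′ (suc (suc zero)) id
             +ᵥ Σᵥ (λ u → f (tree u p s) ·ᵥ rel′ (suc zero) (transpose a u))

  expansion∈R′ : ∀ f → R′ (expansion f)
  expansion∈R′ f = sp-add
    (sp-add (Span-Σᵥ λ u → sp-scale (f (tree u s s)) (generator zero (transpose a u)))
            (sp-scale (f (tree a p p)) (generator (suc (suc zero)) id)))
    (Span-Σᵥ λ u → sp-scale (f (tree u p s)) (generator (suc zero) (transpose a u)))
    where
    generator : ∀ j τ → R′ (rel′ j τ)
    generator j τ = sp-gen ((j , τ) , refl)

  expansion-at : ∀ f v g₁ g₂ → expansion f (tree v g₁ g₂) ≈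
      sumLabel (λ u → f (tree u s s) * coeff′ zero (transpose a u) v g₁ g₂)
    + f (tree a p p) * coeff′ (suc (suc zero)) id v g₁ g₂
    + sumLabel (λ u → f (tree u p s) * coeff′ (suc zero) (transpose a u) v g₁ g₂)
  expansion-at f v g₁ g₂ = +-cong
    (+-cong (sumLabel-cong λ u → *-congˡ {f (tree u s s)} (rel′≈coeff′ zero (transpose a u) v g₁ g₂))
            (*-congˡ (rel′≈coeff′ (suc (suc zero)) id v g₁ g₂)))
    (sumLabel-cong λ u → *-congˡ {f (tree u p s)} (rel′≈coeff′ (suc zero) (transpose a u) v g₁ g₂))

  expansion-ss : ∀ f v → expansion f (tree v s s) ≈ f (tree v s s)
  expansion-ss f v = begin
    expansion f (tree v s s)   ≈⟨ expansion-at f v s s ⟩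
    sumLabel (λ u → f (tree u s s) * [ v ≐ u ]) + f (tree a p p) * 0#
      + sumLabel (λ u → f (tree u p s) * 0#)
                               ≈⟨ +-cong (+-cong (sumLabel-δ′ v (λ u → f (tree u s s))) (zeroʳ _))
                                         (sumLabel-zeroʳ (λ u → f (tree u p s))) ⟩
    f (tree v s s) + 0# + 0#   ≈⟨ trans (+-identityʳ _) (+-identityʳ _) ⟩
    f (tree v s s)             ∎

  expansion-pp : ∀ f → expansion f (tree a p p) ≈ f (tree a p p)
  expansion-pp f = begin
    expansion f (tree a p p)   ≈⟨ expansion-at f a p p ⟩
    sumLabel (λ u → f (tree u s s) * 0#) + f (tree a p p) * 1#
      + sumLabel (λ u → f (tree u p s) * 0#)
                               ≈⟨ +-cong (+-cong (sumLabel-zeroʳ (λ u → f (tree u s s))) (*-identityʳ _))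
                                         (sumLabel-zeroʳ (λ u → f (tree u p s))) ⟩
    0# + f (tree a p p) + 0#   ≈⟨ trans (+-identityʳ _) (+-identityˡ _) ⟩
    f (tree a p p)             ∎

  expansion-ps : ∀ f v → expansion f (tree v p s) ≈ f (tree v p s)
  expansion-ps f v = begin
    expansion f (tree v p s)   ≈⟨ expansion-at f v p s ⟩
    sumLabel (λ u → f (tree u s s) * 0#) + f (tree a p p) * 0#
      + sumLabel (λ u → f (tree u p s) * [ v ≐ u ])
                               ≈⟨ +-cong (+-cong (sumLabel-zeroʳ (λ u → f (tree u s s))) (zeroʳ _))
                                         (sumLabel-δ′ v (λ u → f (tree u p s))) ⟩
    0# + 0# + f (tree v p s)   ≈⟨ trans (+-congʳ (+-identityʳ 0#)) (+-identityˡ _) ⟩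
    f (tree v p s)             ∎

  R⊥⊆R′ : ∀ {f} → R⊥ f → R′ f
  R⊥⊆R′ {f} f⊥R = sp-resp expansion≈f (expansion∈R′ f)
    where
    residual⊥R : R⊥ (f -ᵥ expansion f)
    residual⊥R = R⊥-−ᵥ {f} {expansion f} f⊥R (R′⊆R⊥ {expansion f} (expansion∈R′ f))

    residual≈0 : ∀ {t} → expansion f t ≈ f t → f t - expansion f t ≈ 0#
    residual≈0 e = x≈y⇒x∙y⁻¹≈ε (sym e)

    expansion≈f : expansion f ≈ᵥ f
    expansion≈f t = sym (x∙y⁻¹≈ε⇒x≈y _ _ (R⊥-vanishing {f -ᵥ expansion f} residual⊥R
      (λ u → residual≈0 (expansion-ss f u)) (residual≈0 (expansion-pp f))
      (λ u → residual≈0 (expansion-ps f u)) t))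

mainTheorem10 : ∀ {c ℓ : Level} (K : Field c ℓ) → CharZero K →
    let open Spaces K in
    ∀ (f : FreeG∨₃) → (R⊥ f → R′ f) × (R′ f → R⊥ f)
mainTheorem10 K _ f = R⊥⊆R′ , R′⊆R⊥
  where open KoszulDual K
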